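{- Let $N_1,N_2\ge2$, $1\le x\le N_1-1$, $1\le y\le N_2-1$. Consider the state with $N_1+N_2$ violinists, at most one per room, whose occupied rooms in $\{0,\dots,2N_1-1\}$ form the shadow $F_{N_1,x}$ with leftmost violinist in room $0$, and whose occupied rooms in $\{2N_1,2N_1+1,\dots\}$ form the shadow $F_{N_2,y}$ with leftmost violinist in room $2N_1$ (and no other violinists). Then every final state reachable from this state has shadow $F_{N_1+N_2,\,x+y}$.
   Context: Rooms are indexed by the integers, room $i$ adjacent to rooms $i\pm1$. A state is a finite placement of indistinguishable violinists in rooms. A move is possible whenever two adjacent rooms $i,i+1$ are both occupied: one violinist leaves room $i$ for the nearest unoccupied room to the left of $i$, and one violinist leaves room $i+1$ for the nearest unoccupied room to the right of $i+1$. A state is final if no move is possible; reachable means obtained by a finite (possibly empty) sequence of moves. For a state with at most one violinist per room, its shadow is the $0/1$ word recording occupancy from its leftmost to its rightmost occupied room. For $N\ge2$ and $1\le k\le N-1$, $F_{N,k}$ is the shadow with $N$ ones in which consecutive ones are separated by a single $0$, except the $k$-th and $(k+1)$-st ones, separated by $00$ (e.g. $F_{3,2}=101001$); note $F_{N,k}$ has length $2N$. -}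

module Defs where

open import Data.Bool using (Bool; true; false)
open import Data.Nat as ℕ using (ℕ; zero; suc; _∸_)
open import Data.Integer as ℤ using (ℤ; +_; _+_; _-_; _<_; _≤_)
open import Data.List using (List; []; _∷_; _++_; length; lookup)
open import Data.List.Membership.Propositional using (_∈_; _∉_)
open import Data.List.Relation.Unary.Unique.Propositional using (Unique)
open import Data.List.Relation.Binary.Permutation.Propositional using (_↭_)
open import Data.Fin using (Fin; toℕ)
open import Data.Product using (Σ; ∃; _×_; _,_)
open import Data.Empty using (⊥)
open import Relation.Binary.PropositionalEquality using (_≡_)
open import Relation.Binary.Construct.Closure.ReflexiveTransitive using (Star)

-- A state: a finite multiset of rooms (one entry per violinist),
-- represented by a list of integers taken up to permutation.
State : Set
State = List ℤ

Unoccupied : State → ℤ → Set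
Unoccupied s m = m ∉ s

-- One move: rooms i, i+1 both occupied; one violinist from i goes to j,
-- the nearest unoccupied room to the left of i, and one violinist from
-- i+1 goes to k, the nearest unoccupied room to the right of i+1
-- (nearest with respect to the occupancy of s before the move).
record Move (s t : State) : Set where
  field
    i j k : ℤ
    rest  : State
    before : s ↭ (i ∷ (i + ℤ.1ℤ) ∷ rest)
    after  : t ↭ (j ∷ k ∷ rest)
    j<i    : j < i
    j-free : Unoccupied s j
    j-near : ∀ m → j < m → m < i → m ∈ s
    i+1<k  : (i + ℤ.1ℤ) < k
    k-free : Unoccupied s k
    k-near : ∀ m → (i + ℤ.1ℤ) < m → m < k → m ∈ s

Reachable : State → State → Set
Reachable = Star Move

-- Final: no move is possible, i.e. no two adjacent rooms are both occupied.
Final : State → Set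
Final s = ∀ i → i ∈ s → (i + ℤ.1ℤ) ∈ s → ⊥

record HasShadow (s : State) (w : List Bool) : Set where
  field
    atMostOne : Unique s
    a         : ℤ
    nonempty  : 1 ℕ.≤ length w
    leftmost  : a ∈ s
    rightmost : (a + + (length w ∸ 1)) ∈ s
    bounded   : ∀ m → m ∈ s → a ≤ m × m ≤ a + + (length w ∸ 1)
    letters   : ∀ (p : Fin (length w)) →
                (lookup w p ≡ true → (a + + toℕ p) ∈ s) ×
                ((a + + toℕ p) ∈ s → lookup w p ≡ true)

rep : ℕ → List Bool → List Bool
rep zero    w = []
rep (suc n) w = w ++ rep n w

-- F_{N,k}: N ones, consecutive ones separated by 0, except the k-th and
-- (k+1)-st separated by 00.  E.g. F 3 2 = 101001.
F : ℕ → ℕ → List Bool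
F N k = rep k (true ∷ false ∷ []) ++ false ∷ true ∷ rep (N ∸ k ∸ 1) (false ∷ true ∷ [])

-- The state with at most one violinist per room whose shadow is w,
-- leftmost violinist in room a (w assumed to start with a 1).
place : List Bool → ℤ → State
place []          a = []
place (true ∷ w)  a = a ∷ place w (a + ℤ.1ℤ)
place (false ∷ w) a = place w (a + ℤ.1ℤ)

initial : ℕ → ℕ → ℕ → ℕ → State
initial N₁ N₂ x y = place (F N₁ x) (+ 0) ++ place (F N₂ y) (+ (2 ℕ.* N₁))

module Submission where

-- Rooms 2r and 2r+1 form block r.  The initial state has exactly one violinist in each of the
-- N₁ + N₂ blocks 0, …, N₁ + N₂ − 1, and moves preserve this: two adjacent occupied rooms must be
-- the right room of some block r and the left room of block r + 1, so the nearest free rooms are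
-- the other rooms of these two blocks and the move just flips both blocks to their other side.
-- Hence the number of blocks occupied on their left side, initially x + y, is invariant.  In a
-- final state no right-occupied block is followed by a left-occupied one, so the x + y
-- left-occupied blocks come first, and that is the shadow F (N₁ + N₂) (x + y).

open import Defs
open import Data.Nat using (ℕ; _+_; _≤_; _<_)

open import Data.Bool using (Bool; true; false; not)
open import Data.Bool.Properties using (not-¬)
open import Data.Empty using (⊥-elim)
open import Data.Fin using (Fin; toℕ)
import Data.Fin as Fin
open import Data.Integer as ℤ using (ℤ; +_; 1ℤ; +≤+)
import Data.Integer.Properties as ℤₚ
open import Data.List using (List; []; _∷_; _++_; length; lookup)
open import Data.List.Properties using (++-assoc)
open import Data.List.Membership.Propositional using (_∈_; _∉_)
open import Data.List.Relation.Binary.Permutation.Propositional using (_↭_; ↭-sym; ↭⇒↭ₛ)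
open import Data.List.Relation.Binary.Permutation.Propositional.Properties using (∈-resp-↭)
open import Data.List.Relation.Binary.Permutation.Setoid.Properties (ℤₚ.≡-setoid) using (Unique-resp-↭)
open import Data.List.Relation.Unary.All as All using (All; _∷_)
open import Data.List.Relation.Unary.AllPairs using ([]; _∷_)
open import Data.List.Relation.Unary.Any using (here; there)
open import Data.List.Relation.Unary.Unique.Propositional using (Unique)
open import Data.Nat as ℕ using (zero; suc; z≤n; s≤s; _∸_; ⌊_/2⌋)
open import Data.Nat.Properties
open import Algebra.Properties.CommutativeSemigroup +-commutativeSemigroup using (x∙yz≈y∙xz)
open import Data.Product using (∃-syntax; _×_; _,_; proj₂)
open import Data.Sum using (_⊎_; inj₁; inj₂)
open import Function using (_∘_)
open import Relation.Binary.Construct.Closure.ReflexiveTransitive using (ε; _◅_)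
open import Relation.Binary.Definitions using (tri<; tri≈; tri>)
open import Relation.Binary.PropositionalEquality
open import Relation.Nullary using (yes; no; contradiction)

double : ℕ → ℕ
double zero    = zero
double (suc n) = suc (suc (double n))

double≡2* : ∀ n → double n ≡ 2 ℕ.* n
double≡2* zero    = refl
double≡2* (suc n) = cong suc (trans (cong suc (double≡2* n)) (sym (+-suc n (n + 0))))

room : Bool → ℕ → ℕ
room false r = double r
room true  r = suc (double r)

⌊room/2⌋≡ : ∀ b r → ⌊ room b r /2⌋ ≡ r
⌊room/2⌋≡ false zero    = refl
⌊room/2⌋≡ true  zero    = refl
⌊room/2⌋≡ false (suc r) = cong suc (⌊room/2⌋≡ false r)
⌊room/2⌋≡ true  (suc r) = cong suc (⌊room/2⌋≡ true r)

room-injective : ∀ {u v a b} → room u a ≡ room v b → u ≡ v × a ≡ b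
room-injective {u} {v} {a} {b} eq
  with trans (sym (⌊room/2⌋≡ u a)) (trans (cong ⌊_/2⌋ eq) (⌊room/2⌋≡ v b))
room-injective {false} {false} eq | refl = refl , refl
room-injective {true}  {true}  eq | refl = refl , refl
room-injective {false} {true}  eq | refl = ⊥-elim (1+n≢n (sym eq))
room-injective {true}  {false} eq | refl = ⊥-elim (1+n≢n eq)

room-adjacent : ∀ {u v a b} → suc (room u a) ≡ room v b →
                (u ≡ true × v ≡ false × b ≡ suc a) ⊎ (u ≡ false × v ≡ true × b ≡ a)
room-adjacent {false} eq with room-injective {true} eq
... | v≡true , a≡b = inj₂ (refl , sym v≡true , sym a≡b)
room-adjacent {true} {a = a} eq with room-injective {false} {a = suc a} eq
... | v≡false , 1+a≡b = inj₁ (refl , sym v≡false , sym 1+a≡b)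

room-step : ∀ b r → room b (suc r) ≡ suc (suc (room b r))
room-step false r = refl
room-step true  r = refl

room≤ : ∀ b {r n} → r ≤ n → room b r ≤ room true n
room≤ false z≤n     = z≤n
room≤ true  z≤n     = s≤s z≤n
room≤ false (s≤s p) = s≤s (s≤s (room≤ false p))
room≤ true  (s≤s p) = s≤s (s≤s (room≤ true p))

-- Block r of a configuration e is occupied on side e r.
Config : Set
Config = ℕ → Bool

countLeft : Bool → ℕ
countLeft false = 1
countLeft true  = 0

lefts : Config → ℕ → ℕ
lefts e zero    = 0
lefts e (suc n) = countLeft (e 0) + lefts (e ∘ suc) n

sorted : ℕ → Config
sorted zero    r       = true
sorted (suc K) zero    = false
sorted (suc K) (suc r) = sorted K r

sorted-≤ : ∀ {K r} → K ≤ r → sorted K r ≡ true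
sorted-≤ z≤n     = refl
sorted-≤ (s≤s p) = sorted-≤ p

lefts-sorted : ∀ {K n} → K ≤ n → lefts (sorted K) n ≡ K
lefts-sorted {zero}  {zero}  _       = refl
lefts-sorted {zero}  {suc n} _       = lefts-sorted {zero} {n} z≤n
lefts-sorted {suc K} {suc n} (s≤s p) = cong suc (lefts-sorted p)

append : ℕ → Config → Config → Config
append zero    f g         = g
append (suc n) f g zero    = f 0
append (suc n) f g (suc r) = append n (f ∘ suc) g r

lefts-append : ∀ n m f g → lefts (append n f g) (n + m) ≡ lefts f n + lefts g m
lefts-append zero    m f g = refl
lefts-append (suc n) m f g =
  trans (cong (countLeft (f 0) ℕ.+_) (lefts-append n m (f ∘ suc) g))
        (sym (+-assoc (countLeft (f 0)) _ _))

swap : ℕ → Config → Config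
swap zero    e zero          = e 1
swap zero    e (suc zero)    = e 0
swap zero    e (suc (suc q)) = e (suc (suc q))
swap (suc r) e zero          = e 0
swap (suc r) e (suc q)       = swap r (e ∘ suc) q

swap-here : ∀ r e → swap r e r ≡ e (suc r)
swap-here zero    e = refl
swap-here (suc r) e = swap-here r (e ∘ suc)

swap-next : ∀ r e → swap r e (suc r) ≡ e r
swap-next zero    e = refl
swap-next (suc r) e = swap-next r (e ∘ suc)

swap-other : ∀ r e q → q ≢ r → q ≢ suc r → swap r e q ≡ e q
swap-other zero    e zero          q≢r _     = ⊥-elim (q≢r refl)
swap-other zero    e (suc zero)    _   q≢1+r = ⊥-elim (q≢1+r refl)
swap-other zero    e (suc (suc q)) _   _     = refl
swap-other (suc r) e zero          _   _     = refl
swap-other (suc r) e (suc q) q≢r q≢1+r =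
  swap-other r (e ∘ suc) q (q≢r ∘ cong suc) (q≢1+r ∘ cong suc)

lefts-swap : ∀ r e {n} → suc r < n → lefts (swap r e) n ≡ lefts e n
lefts-swap zero    e {suc zero}    (s≤s ())
lefts-swap zero    e {suc (suc n)} _ = x∙yz≈y∙xz (countLeft (e 1)) (countLeft (e 0)) _
lefts-swap (suc r) e {suc n} (s≤s p) = cong (countLeft (e 0) ℕ.+_) (lefts-swap r (e ∘ suc) p)

Ascending : ℕ → Config → Set
Ascending n e = ∀ r → suc r < n → e r ≡ true → e (suc r) ≡ true

ascending-true : ∀ {n e} → Ascending n e → e 0 ≡ true → ∀ r → r < n → e r ≡ true
ascending-true asc e0 zero    _ = e0
ascending-true asc e0 (suc r) p = asc r p (ascending-true asc e0 r (<-trans (n<1+n r) p))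

lefts-true : ∀ {e} n → (∀ r → r < n → e r ≡ true) → lefts e n ≡ 0
lefts-true zero    _    = refl
lefts-true (suc n) all-true rewrite all-true 0 (s≤s z≤n) =
  lefts-true n (λ r p → all-true (suc r) (s≤s p))

ascending⇒sorted : ∀ {n e} → Ascending n e → ∀ r → r < n → e r ≡ sorted (lefts e n) r
ascending⇒sorted {suc n} {e} asc r r<n with e 0 in e0
... | true  rewrite lefts-true n (λ q p → ascending-true asc e0 (suc q) (s≤s p)) =
      ascending-true asc e0 r r<n
... | false with r
...   | zero = e0
...   | suc q = ascending⇒sorted (λ q' p → asc (suc q') (s≤s p)) q (≤-pred r<n)

block : Bool → List Bool
block false = true ∷ false ∷ []
block true  = false ∷ true ∷ []

blocks : Config → ℕ → List Bool
blocks e zero    = []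
blocks e (suc n) = block (e 0) ++ blocks (e ∘ suc) n

length-blocks : ∀ e n → length (blocks e n) ≡ double n
length-blocks e zero    = refl
length-blocks e (suc n) with e 0
... | false = cong (suc ∘ suc) (length-blocks (e ∘ suc) n)
... | true  = cong (suc ∘ suc) (length-blocks (e ∘ suc) n)

blocks-append : ∀ n m f g → blocks (append n f g) (n + m) ≡ blocks f n ++ blocks g m
blocks-append zero    m f g = refl
blocks-append (suc n) m f g =
  trans (cong (block (f 0) ++_) (blocks-append n m (f ∘ suc) g)) (sym (++-assoc (block (f 0)) _ _))

rep-blocks : ∀ n → rep n (false ∷ true ∷ []) ≡ blocks (sorted 0) n
rep-blocks zero    = refl
rep-blocks (suc n) = cong (λ w → false ∷ true ∷ w) (rep-blocks n)

F≡blocks : ∀ {N K} → K < N → F N K ≡ blocks (sorted K) N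
F≡blocks {suc N} {zero}  _       = cong (λ w → false ∷ true ∷ w) (rep-blocks N)
F≡blocks {suc N} {suc K} (s≤s p) = cong (λ w → true ∷ false ∷ w) (F≡blocks p)

at : List Bool → ℕ → Bool
at []      _       = false
at (b ∷ w) zero    = b
at (b ∷ w) (suc q) = at w q

lookup≡at : ∀ w (p : Fin (length w)) → lookup w p ≡ at w (toℕ p)
lookup≡at (b ∷ w) Fin.zero    = refl
lookup≡at (b ∷ w) (Fin.suc p) = lookup≡at w p

at-block : ∀ b w q → at (block b ++ w) (suc (suc q)) ≡ at w q
at-block false w q = refl
at-block true  w q = refl

at-blocks-room : ∀ e {n r} → r < n → at (blocks e n) (room (e r) r) ≡ true
at-blocks-room e {suc n} {zero} _ with e 0
... | false = refl
... | true  = refl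
at-blocks-room e {suc n} {suc r} (s≤s p) =
  trans (cong (at (blocks e (suc n))) (room-step (e (suc r)) r))
        (trans (at-block (e 0) _ _) (at-blocks-room (e ∘ suc) p))

at-blocks : ∀ e n q → at (blocks e n) q ≡ true → ∃[ r ] r < n × q ≡ room (e r) r
at-blocks e (suc n) (suc (suc q)) h with at-blocks (e ∘ suc) n q (trans (sym (at-block (e 0) _ q)) h)
... | r , p , eq = suc r , s≤s p , trans (cong (suc ∘ suc) eq) (sym (room-step (e (suc r)) r))
at-blocks e (suc n) zero h with e 0 in e0
at-blocks e (suc n) zero h  | false = 0 , s≤s z≤n , cong (λ b → room b 0) (sym e0)
at-blocks e (suc n) zero () | true
at-blocks e (suc n) (suc zero) h with e 0 in e0
at-blocks e (suc n) (suc zero) () | false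
at-blocks e (suc n) (suc zero) h  | true = 0 , s≤s z≤n , cong (λ b → room b 0) (sym e0)

pos+1 : ∀ n → + n ℤ.+ 1ℤ ≡ + suc n
pos+1 n = cong +_ (+-comm n 1)

i<i+1 : ∀ i → i ℤ.< i ℤ.+ 1ℤ
i<i+1 i = ℤₚ.suc[i]≤j⇒i<j (ℤₚ.≤-reflexive (ℤₚ.+-comm 1ℤ i))

place-++ : ∀ u v a → place (u ++ v) a ≡ place u a ++ place v (a ℤ.+ + length u)
place-++ []          v a = cong (place v) (sym (ℤₚ.+-identityʳ a))
place-++ (true ∷ u)  v a =
  cong (a ∷_) (trans (place-++ u v (a ℤ.+ 1ℤ)) (cong (λ b → place u _ ++ place v b) (ℤₚ.+-assoc a 1ℤ _)))
place-++ (false ∷ u) v a =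
  trans (place-++ u v (a ℤ.+ 1ℤ)) (cong (λ b → place u _ ++ place v b) (ℤₚ.+-assoc a 1ℤ _))

∈-place : ∀ w a {m} → m ∈ place w a → ∃[ q ] at w q ≡ true × m ≡ a ℤ.+ + q
∈-place (true ∷ w)  a (here refl) = 0 , refl , sym (ℤₚ.+-identityʳ a)
∈-place (true ∷ w)  a (there m∈) with ∈-place w (a ℤ.+ 1ℤ) m∈
... | q , wq , refl = suc q , wq , ℤₚ.+-assoc a 1ℤ (+ q)
∈-place (false ∷ w) a m∈ with ∈-place w (a ℤ.+ 1ℤ) m∈
... | q , wq , refl = suc q , wq , ℤₚ.+-assoc a 1ℤ (+ q)

place-∈ : ∀ w a {q} → at w q ≡ true → a ℤ.+ + q ∈ place w a
place-∈ (true ∷ w) a {zero} _ = here (ℤₚ.+-identityʳ a)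
place-∈ (b ∷ w) a {suc q} wq =
  subst (_∈ place (b ∷ w) a) (ℤₚ.+-assoc a 1ℤ (+ q)) (tail b (place-∈ w (a ℤ.+ 1ℤ) wq))
  where tail : ∀ b {m} → m ∈ place w (a ℤ.+ 1ℤ) → m ∈ place (b ∷ w) a
        tail true  = there
        tail false m∈ = m∈

place-≥ : ∀ w a {m} → m ∈ place w a → a ℤ.≤ m
place-≥ w a m∈ with ∈-place w a m∈
... | q , _ , refl = ℤₚ.i≤i+j a (+ q)

place-unique : ∀ w a → Unique (place w a)
place-unique []          a = []
place-unique (true ∷ w)  a =
  All.tabulate (λ m∈ a≡m → ℤₚ.<-irrefl a≡m (ℤₚ.<-≤-trans (i<i+1 a) (place-≥ w _ m∈)))
  ∷ place-unique w (a ℤ.+ 1ℤ)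
place-unique (false ∷ w) a = place-unique w (a ℤ.+ 1ℤ)

record IsLayout (N : ℕ) (e : Config) (s : State) : Set where
  field
    unique   : Unique s
    sound    : ∀ {m} → m ∈ s → ∃[ r ] r < N × m ≡ + room (e r) r
    complete : ∀ {r} → r < N → + room (e r) r ∈ s

open IsLayout

layout-cong : ∀ {N e e' s} → IsLayout N e s → (∀ r → r < N → e r ≡ e' r) → IsLayout N e' s
layout-cong L e≈e' = record
  { unique   = unique L
  ; sound    = λ m∈ → let r , r<N , m≡ = sound L m∈
                      in r , r<N , trans m≡ (cong (λ b → + room b r) (e≈e' r r<N))
  ; complete = λ {r} r<N → subst (λ b → + room b r ∈ _) (e≈e' r r<N) (complete L r<N)
  }

place-blocks-layout : ∀ N e → IsLayout N e (place (blocks e N) (+ 0))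
place-blocks-layout N e = record
  { unique   = place-unique (blocks e N) (+ 0)
  ; sound    = λ m∈ → let q , eq , m≡ = ∈-place (blocks e N) (+ 0) m∈
                          r , r<N , q≡ = at-blocks e N q eq
                      in r , r<N , trans m≡ (cong +_ q≡)
  ; complete = λ r<N → place-∈ (blocks e N) (+ 0) (at-blocks-room e r<N)
  }

initial≡place : ∀ N₁ N₂ x y → x < N₁ → y < N₂ →
                initial N₁ N₂ x y ≡ place (blocks (append N₁ (sorted x) (sorted y)) (N₁ + N₂)) (+ 0)
initial≡place N₁ N₂ x y x<N₁ y<N₂ = begin
  place (F N₁ x) (+ 0) ++ place (F N₂ y) (+ (2 ℕ.* N₁))
    ≡⟨ cong₂ (λ u v → place u (+ 0) ++ place v (+ (2 ℕ.* N₁))) (F≡blocks x<N₁) (F≡blocks y<N₂) ⟩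
  place (blocks (sorted x) N₁) (+ 0) ++ place (blocks (sorted y) N₂) (+ (2 ℕ.* N₁))
    ≡⟨ cong (λ n → place (blocks (sorted x) N₁) (+ 0) ++ place (blocks (sorted y) N₂) (+ n))
            (sym (trans (length-blocks (sorted x) N₁) (double≡2* N₁))) ⟩
  place (blocks (sorted x) N₁) (+ 0) ++ place (blocks (sorted y) N₂) (+ length (blocks (sorted x) N₁))
    ≡⟨ sym (place-++ (blocks (sorted x) N₁) _ (+ 0)) ⟩
  place (blocks (sorted x) N₁ ++ blocks (sorted y) N₂) (+ 0)
    ≡⟨ cong (λ w → place w (+ 0)) (sym (blocks-append N₁ N₂ (sorted x) (sorted y))) ⟩
  place (blocks (append N₁ (sorted x) (sorted y)) (N₁ + N₂)) (+ 0) ∎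
  where open ≡-Reasoning

initial-layout : ∀ {N₁ N₂ x y} → x < N₁ → y < N₂ →
                 IsLayout (N₁ + N₂) (append N₁ (sorted x) (sorted y)) (initial N₁ N₂ x y)
initial-layout {N₁} {N₂} {x} {y} x<N₁ y<N₂ =
  subst (IsLayout (N₁ + N₂) _) (sym (initial≡place N₁ N₂ x y x<N₁ y<N₂)) (place-blocks-layout (N₁ + N₂) _)

lefts-initial : ∀ {N₁ N₂ x y} → x < N₁ → y < N₂ →
                lefts (append N₁ (sorted x) (sorted y)) (N₁ + N₂) ≡ x + y
lefts-initial {N₁} {N₂} {x} {y} x<N₁ y<N₂ =
  trans (lefts-append N₁ N₂ (sorted x) (sorted y))
        (cong₂ _+_ (lefts-sorted (<⇒≤ x<N₁)) (lefts-sorted (<⇒≤ y<N₂)))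

other-side-free : ∀ {N e s} → IsLayout N e s → ∀ r → + room (not (e r)) r ∉ s
other-side-free {e = e} L r m∈ with sound L m∈
... | q , _ , eq with room-injective {not (e r)} {e q} {r} (ℤₚ.+-injective eq)
...   | side , refl = not-¬ refl (sym side)

nearestˡ : ∀ {s : State} {j n} → j ℤ.< n ℤ.+ 1ℤ → n ∉ s →
           (∀ m → j ℤ.< m → m ℤ.< n ℤ.+ 1ℤ → m ∈ s) → j ≡ n
nearestˡ {j = j} {n} j<n+1 n∉s near with ℤₚ.<-cmp j n
... | tri< j<n _ _ = ⊥-elim (n∉s (near n j<n (i<i+1 n)))
... | tri≈ _ j≡n _ = j≡n
... | tri> _ _ n<j = ⊥-elim (ℤₚ.<⇒≱ j<n+1 (subst (ℤ._≤ j) (ℤₚ.+-comm 1ℤ n) (ℤₚ.i<j⇒suc[i]≤j n<j)))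

nearestʳ : ∀ {s : State} {i k} → i ℤ.< k → i ℤ.+ 1ℤ ∉ s →
           (∀ m → i ℤ.< m → m ℤ.< k → m ∈ s) → k ≡ i ℤ.+ 1ℤ
nearestʳ {i = i} {k} i<k i+1∉s near with ℤₚ.<-cmp (i ℤ.+ 1ℤ) k
... | tri< i+1<k _ _ = ⊥-elim (i+1∉s (near _ (i<i+1 i) i+1<k))
... | tri≈ _ i+1≡k _ = sym i+1≡k
... | tri> _ _ k<i+1 = ⊥-elim (ℤₚ.<⇒≱ k<i+1 (subst (ℤ._≤ k) (ℤₚ.+-comm 1ℤ i) (ℤₚ.i<j⇒suc[i]≤j i<k)))

move-descent : ∀ {N e s t} → IsLayout N e s → (mv : Move s t) →
               ∃[ r ] suc r < N × e r ≡ true × e (suc r) ≡ false × Move.i mv ≡ + room true r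
move-descent {e = e} L mv
  with sound L (∈-resp-↭ (↭-sym before) (here refl))
     | sound L (∈-resp-↭ (↭-sym before) (there (here refl)))
  where open Move mv
... | r , _ , i≡ | r' , r'<N , i+1≡
  with room-adjacent {e r} {e r'} {r} {r'}
         (ℤₚ.+-injective (trans (sym (pos+1 _)) (trans (cong (ℤ._+ 1ℤ) (sym i≡)) i+1≡)))
...   | inj₁ (er , e1+r , refl) = r , r'<N , er , e1+r , trans i≡ (cong (λ b → + room b r) er)
...   | inj₂ (er , e1+r , refl) = contradiction (trans (sym er) e1+r) λ ()

rest-rooms : ∀ {N e s r rest} → IsLayout N e s →
             s ↭ + room (e r) r ∷ + room (e (suc r)) (suc r) ∷ rest →
             ∀ {m} → m ∈ rest → ∃[ q ] q < N × q ≢ r × q ≢ suc r × m ≡ + room (e q) q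
rest-rooms {r = r} L s↭ {m} m∈ with sound L (∈-resp-↭ (↭-sym s↭) (there (there m∈)))
                                   | Unique-resp-↭ (↭⇒↭ₛ s↭) (unique L)
... | q , q<N , m≡ | r∉ ∷ 1+r∉ ∷ _ = q , q<N , q≢r , q≢1+r , m≡
  where
    q≢r : q ≢ r
    q≢r refl = All.lookup r∉ (there m∈) (sym m≡)
    q≢1+r : q ≢ suc r
    q≢1+r refl = All.lookup 1+r∉ m∈ (sym m≡)

layout-swap : ∀ {N e s t r rest} → IsLayout N e s → suc r < N →
              s ↭ + room (e r) r ∷ + room (e (suc r)) (suc r) ∷ rest →
              t ↭ + room (e (suc r)) r ∷ + room (e r) (suc r) ∷ rest →
              IsLayout N (swap r e) t
layout-swap {N} {e} {s} {t} {r} {rest} L 1+r<N s↭ t↭ = record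
  { unique   = Unique-resp-↭ (↭⇒↭ₛ (↭-sym t↭))
                 ((j≢k ∷ All.tabulate (λ m∈ j≡m → r∉ (e (suc r)) (subst (_∈ rest) (sym j≡m) m∈)))
                  ∷ All.tabulate (λ m∈ k≡m → 1+r∉ (e r) (subst (_∈ rest) (sym k≡m) m∈))
                  ∷ unique-rest)
  ; sound    = sound′ ∘ ∈-resp-↭ t↭
  ; complete = ∈-resp-↭ (↭-sym t↭) ∘ complete′
  }
  where
    old-rooms = Unique-resp-↭ (↭⇒↭ₛ s↭) (unique L)
    unique-rest : Unique rest
    unique-rest with old-rooms
    ... | _ ∷ _ ∷ u = u

    r∉ : ∀ b → + room b r ∉ rest
    r∉ b m∈ with rest-rooms L s↭ m∈
    ... | q , _ , q≢r , _ , eq = q≢r (sym (proj₂ (room-injective {b} {e q} (ℤₚ.+-injective eq))))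
    1+r∉ : ∀ b → + room b (suc r) ∉ rest
    1+r∉ b m∈ with rest-rooms L s↭ m∈
    ... | q , _ , _ , q≢1+r , eq = q≢1+r (sym (proj₂ (room-injective {b} {e q} (ℤₚ.+-injective eq))))
    j≢k : + room (e (suc r)) r ≢ + room (e r) (suc r)
    j≢k eq = 1+n≢n (sym (proj₂ (room-injective {e (suc r)} {e r} (ℤₚ.+-injective eq))))

    sound′ : ∀ {m} → m ∈ + room (e (suc r)) r ∷ + room (e r) (suc r) ∷ rest →
             ∃[ q ] q < N × m ≡ + room (swap r e q) q
    sound′ (here refl)         = r , <-trans (n<1+n r) 1+r<N ,
                                 cong (λ b → + room b r) (sym (swap-here r e))
    sound′ (there (here refl)) = suc r , 1+r<N , cong (λ b → + room b (suc r)) (sym (swap-next r e))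
    sound′ (there (there m∈)) with rest-rooms L s↭ m∈
    ... | q , q<N , q≢r , q≢1+r , m≡ =
      q , q<N , trans m≡ (cong (λ b → + room b q) (sym (swap-other r e q q≢r q≢1+r)))

    complete′ : ∀ {q} → q < N →
                + room (swap r e q) q ∈ + room (e (suc r)) r ∷ + room (e r) (suc r) ∷ rest
    complete′ {q} q<N with q ℕ.≟ r | q ℕ.≟ suc r
    ... | yes refl | _        = here (cong (λ b → + room b r) (swap-here r e))
    ... | no _     | yes refl = there (here (cong (λ b → + room b (suc r)) (swap-next r e)))
    ... | no q≢r   | no q≢1+r =
      there (there (subst (_∈ rest) (cong (λ b → + room b q) (sym (swap-other r e q q≢r q≢1+r)))
                          (in-rest (∈-resp-↭ s↭ (complete L q<N)))))
      where
        in-rest : + room (e q) q ∈ + room (e r) r ∷ + room (e (suc r)) (suc r) ∷ rest →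
                  + room (e q) q ∈ rest
        in-rest (here eq)          = ⊥-elim (q≢r (proj₂ (room-injective {e q} {e r} (ℤₚ.+-injective eq))))
        in-rest (there (here eq))  = ⊥-elim (q≢1+r (proj₂ (room-injective {e q} {e (suc r)} (ℤₚ.+-injective eq))))
        in-rest (there (there m∈)) = m∈

move-layout : ∀ {N e s t} → IsLayout N e s → Move s t → ∃[ r ] suc r < N × IsLayout N (swap r e) t
move-layout {N} {e} {s} {t} L mv with move-descent L mv
... | r , 1+r<N , er , e1+r , i≡ = r , 1+r<N , layout-swap L 1+r<N s↭ t↭
  where
    open Move mv
    i+1≡ : i ℤ.+ 1ℤ ≡ + room false (suc r)
    i+1≡ = trans (cong (ℤ._+ 1ℤ) i≡) (pos+1 _)
    i+2≡ : i ℤ.+ 1ℤ ℤ.+ 1ℤ ≡ + room true (suc r)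
    i+2≡ = trans (cong (ℤ._+ 1ℤ) i+1≡) (pos+1 _)
    i≡′ : i ≡ + room false r ℤ.+ 1ℤ
    i≡′ = trans i≡ (sym (pos+1 _))

    j≡ : j ≡ + room false r
    j≡ = nearestˡ (subst (j ℤ.<_) i≡′ j<i)
                  (subst (λ b → + room (not b) r ∉ s) er (other-side-free L r))
                  (λ m j<m m<i → j-near m j<m (subst (m ℤ.<_) (sym i≡′) m<i))
    k≡ : k ≡ + room true (suc r)
    k≡ = trans (nearestʳ i+1<k (subst (_∉ s) (sym i+2≡) i+2-free) k-near) i+2≡
      where i+2-free = subst (λ b → + room (not b) (suc r) ∉ s) e1+r (other-side-free L (suc r))

    s↭ : s ↭ + room (e r) r ∷ + room (e (suc r)) (suc r) ∷ rest
    s↭ = subst (s ↭_) (cong₂ (λ a b → a ∷ b ∷ rest)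
                               (trans i≡ (cong (λ b → + room b r) (sym er)))
                               (trans i+1≡ (cong (λ b → + room b (suc r)) (sym e1+r)))) before
    t↭ : t ↭ + room (e (suc r)) r ∷ + room (e r) (suc r) ∷ rest
    t↭ = subst (t ↭_) (cong₂ (λ a b → a ∷ b ∷ rest)
                               (trans j≡ (cong (λ b → + room b r) (sym e1+r)))
                               (trans k≡ (cong (λ b → + room b (suc r)) (sym er)))) after

reachable-layout : ∀ {N e s t} → Reachable s t → IsLayout N e s →
                   ∃[ e' ] IsLayout N e' t × lefts e' N ≡ lefts e N
reachable-layout {e = e} ε         L = e , L , refl
reachable-layout {e = e} (mv ◅ mvs) L with move-layout L mv
... | r , 1+r<N , L′ with reachable-layout mvs L′
...   | e′ , L″ , lefts≡ = e′ , L″ , trans lefts≡ (lefts-swap r e 1+r<N)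

final-ascending : ∀ {N e s} → IsLayout N e s → Final s → Ascending N e
final-ascending {e = e} {s} L final r 1+r<N er with e (suc r) in e1+r
... | true  = refl
... | false = ⊥-elim (final (+ room true r) i∈s i+1∈s)
  where
    i∈s = subst (λ b → + room b r ∈ s) er (complete L (<-trans (n<1+n r) 1+r<N))
    i+1∈s = subst (_∈ s) (sym (trans (pos+1 _) (cong (λ b → + room b (suc r)) (sym e1+r)))) (complete L 1+r<N)

layout-hasShadow : ∀ {n e s} → IsLayout (suc n) e s → e 0 ≡ false → e n ≡ true →
                   HasShadow s (blocks e (suc n))
layout-hasShadow {n} {e} {s} L e0 en = record
  { atMostOne = unique L
  ; a         = + 0
  ; nonempty  = subst (1 ≤_) (sym (length-blocks e (suc n))) (s≤s z≤n)
  ; leftmost  = subst (λ b → + room b 0 ∈ s) e0 (complete L (s≤s z≤n))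
  ; rightmost = subst (_∈ s) (sym last≡) (subst (λ b → + room b n ∈ s) en (complete L ≤-refl))
  ; bounded   = λ m m∈ → let r , r<N , m≡ = sound L m∈ in
                  subst (+ 0 ℤ.≤_) (sym m≡) (+≤+ z≤n) ,
                  subst₂ ℤ._≤_ (sym m≡) (sym last≡) (+≤+ (room≤ (e r) (≤-pred r<N)))
  ; letters   = λ p → letter⇒∈ p , ∈⇒letter p
  }
  where
    w = blocks e (suc n)
    last≡ : + (length w ∸ 1) ≡ + room true n
    last≡ = cong (λ l → + (l ∸ 1)) (length-blocks e (suc n))

    letter⇒∈ : ∀ p → lookup w p ≡ true → + toℕ p ∈ s
    letter⇒∈ p wp with at-blocks e (suc n) (toℕ p) (trans (sym (lookup≡at w p)) wp)
    ... | r , r<N , p≡ = subst (_∈ s) (cong +_ (sym p≡)) (complete L r<N)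
    ∈⇒letter : ∀ p → + toℕ p ∈ s → lookup w p ≡ true
    ∈⇒letter p p∈ with sound L p∈
    ... | r , r<N , p≡ =
      trans (lookup≡at w p) (subst (λ q → at w q ≡ true) (sym (ℤₚ.+-injective p≡)) (at-blocks-room e r<N))

sorted-hasShadow : ∀ {N K s} → 1 ≤ K → K < N → IsLayout N (sorted K) s → HasShadow s (F N K)
sorted-hasShadow {suc n} {suc K} _ K<N@(s≤s K≤n) L =
  subst (HasShadow _) (sym (F≡blocks K<N)) (layout-hasShadow L refl (sorted-≤ K≤n))

final-sorted : ∀ {N e s} → IsLayout N e s → Final s → IsLayout N (sorted (lefts e N)) s
final-sorted L final = layout-cong L (ascending⇒sorted (final-ascending L final))

proposition6p4 : (N₁ N₂ x y : ℕ) → 2 ≤ N₁ → 2 ≤ N₂ →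
                 1 ≤ x → x < N₁ → 1 ≤ y → y < N₂ →
                 (s : State) → Reachable (initial N₁ N₂ x y) s → Final s →
                 HasShadow s (F (N₁ + N₂) (x + y))
proposition6p4 N₁ N₂ x y _ _ 1≤x x<N₁ _ y<N₂ s init↝s final
  with reachable-layout init↝s (initial-layout x<N₁ y<N₂)
... | e , L , lefts≡ =
  sorted-hasShadow (≤-trans 1≤x (m≤m+n x y)) (+-mono-< x<N₁ y<N₂)
    (subst (λ K → IsLayout (N₁ + N₂) (sorted K) s) (trans lefts≡ (lefts-initial x<N₁ y<N₂))
           (final-sorted L final))
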